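{- Let $G$ and $H$ be finite graphs and $s$ a non-negative integer with $2s+1<og(H)$. Then $G^{\frac{1}{2s+1}}\longrightarrow H$ if and only if $G\longrightarrow H^{2s+1}$.
   Context: $G\longrightarrow H$ means there is a homomorphism (adjacency-preserving vertex map) from $G$ to $H$. $og(H)$ is the odd girth of $H$ ($\infty$ if $H$ is bipartite). For a positive integer $k$, $H^{k}$ has vertex set $V(H)$, with $u,v$ adjacent iff there is a walk of length $k$ between them in $H$. $S_t(G)$ is obtained from $G$ by replacing each edge by a path with exactly $t-1$ inner vertices, and $G^{\frac{1}{2s+1}}:=S_{2s+1}(G)$. -}

module Defs where

open import Data.Nat using (ℕ; zero; suc; _+_; _*_; _∸_; _≤_; _<_; s≤s; z≤n; _<?_)
open import Data.Fin using (Fin; zero; suc; inject₁; fromℕ; fromℕ<) renaming (_<_ to _<ᶠ_)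
open import Data.Bool using (Bool; true; false)
open import Data.Product using (Σ; ∃; _×_; _,_)
open import Data.Sum using (_⊎_; inj₁; inj₂)
open import Relation.Nullary using (¬_; yes; no)
open import Relation.Binary.PropositionalEquality using (_≡_)
open import Function using (Injective)

record Graph : Set where
  field
    n      : ℕ
    adj    : Fin n → Fin n → Bool
    sym    : ∀ u v → adj u v ≡ adj v u
    irrefl : ∀ v → adj v v ≡ false

record RGraph : Set₁ where
  field
    V : Set
    E : V → V → Set

open Graph
open RGraph

toR : Graph → RGraph
toR G = record { V = Fin (n G) ; E = λ u v → adj G u v ≡ true }

_⟶_ : RGraph → RGraph → Set
A ⟶ B = Σ (V A → V B) λ f → ∀ u v → E A u v → E B (f u) (f v)

infix 4 _⟶_

data Walk (H : Graph) : Fin (n H) → Fin (n H) → ℕ → Set where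
  here : ∀ v → Walk H v v 0
  step : ∀ {u w v k} → adj H u w ≡ true → Walk H w v k → Walk H u v (suc k)

_^^_ : Graph → ℕ → RGraph
H ^^ k = record { V = Fin (n H) ; E = λ u v → Walk H u v k }

Cycle : (H : Graph) → ℕ → Set
Cycle H zero = Data.Empty.⊥ where import Data.Empty
Cycle H (suc m) =
  Σ (Fin (suc m) → Fin (n H)) λ f →
    Injective _≡_ _≡_ f
    × (∀ (i : Fin m) → adj H (f (inject₁ i)) (f (suc i)) ≡ true)
    × adj H (f (fromℕ m)) (f zero) ≡ true

OddGirth>_ : ℕ → Graph → Set
(OddGirth> k) H = ∀ j → 1 ≤ j → 2 * j + 1 ≤ k → ¬ Cycle H (2 * j + 1)

Edge : Graph → Set
Edge G = Σ (Fin (n G)) λ u → Σ (Fin (n G)) λ v → (u <ᶠ v) × (adj G u v ≡ true)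

private
  pred< : ∀ {i t} → suc i < t → i < t ∸ 1
  pred< {i} {suc t} (s≤s p) = p

SubV : ℕ → Graph → Set
SubV t G = Fin (n G) ⊎ (Edge G × Fin (t ∸ 1))

-- The i-th vertex (0 ≤ i ≤ t) on the path replacing edge e = (u , v):
-- position 0 is u, positions 1..t-1 are the inner vertices, position t is v.
point : ∀ t G → Edge G → ℕ → SubV t G
point t G (u , v , _) zero = inj₁ u
point t G e@(u , v , _) (suc i) with suc i <? t
... | yes p = inj₂ (e , fromℕ< (pred< p))
... | no _  = inj₁ v

-- S_t(G): each edge replaced by a path with exactly t-1 inner vertices.
S : ℕ → Graph → RGraph
S t G = record
  { V = SubV t G
  ; E = λ a b → Σ (Edge G) λ e → Σ ℕ λ i → (suc i ≤ t) ×
          ((a ≡ point t G e i × b ≡ point t G e (suc i))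
           ⊎ (b ≡ point t G e i × a ≡ point t G e (suc i)))
  }

frac : Graph → ℕ → RGraph
frac G s = S (2 * s + 1) G

-- A homomorphism S_t(G) → H sends the path replacing an edge uv to a walk of
-- length t from the image of u to the image of v, and conversely a walk of
-- length t in H can be laid along that path.  So both directions hold for every
-- t ≥ 1 and every H; the odd-girth hypothesis only serves, in the paper, to make
-- H^{2s+1} loopless, whereas here _^^_ may have loops.
module Submission where

open import Defs
open import Data.Nat using (ℕ; zero; suc; _+_; _*_; _≤_; z≤n; s≤s; _<?_)
open import Data.Nat.Properties using (≮⇒≥; n≮n; m≤n+m; +-suc; +-identityʳ)
open import Data.Fin using (Fin; toℕ)
open import Data.Fin.Properties using (toℕ-fromℕ<; <-cmp)
open import Data.Product using (_,_; proj₁; proj₂)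
open import Data.Sum using (inj₁; inj₂)
open import Data.Bool using (true)
open import Data.Empty using (⊥-elim)
open import Relation.Nullary using (yes; no)
open import Relation.Binary using (tri<; tri≈; tri>)
open import Relation.Binary.PropositionalEquality using (_≡_; refl; sym; trans; cong; subst; subst₂)
open import Function.Bundles using (_⇔_; mk⇔)

open Graph hiding (sym)
open RGraph using (E)

module _ {H : Graph} where

  vertex : ∀ {x y k} → Walk H x y k → ℕ → Fin (n H)
  vertex {x} _      zero    = x
  vertex (here v)   (suc i) = v
  vertex (step _ w) (suc i) = vertex w i

  vertex-≥length : ∀ {x y k j} (w : Walk H x y k) → k ≤ j → vertex w j ≡ y
  vertex-≥length {j = zero}  (here v)   _       = refl
  vertex-≥length {j = suc j} (here v)   _       = refl
  vertex-≥length {j = suc j} (step _ w) (s≤s p) = vertex-≥length w p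

  vertex-adjacent : ∀ {x y k} i (w : Walk H x y k) → suc i ≤ k →
                    adj H (vertex w i) (vertex w (suc i)) ≡ true
  vertex-adjacent zero    (step a (here _))   _       = a
  vertex-adjacent zero    (step a (step _ _)) _       = a
  vertex-adjacent (suc i) (step _ w)          (s≤s p) = vertex-adjacent i w p

  walk-along : (p : ℕ → Fin (n H)) → ∀ k →
               (∀ i → suc i ≤ k → adj H (p i) (p (suc i)) ≡ true) → Walk H (p 0) (p k) k
  walk-along p zero    _   = here (p 0)
  walk-along p (suc k) adj-p =
    step (adj-p 0 (s≤s z≤n)) (walk-along (λ i → p (suc i)) k (λ i le → adj-p (suc i) (s≤s le)))

  reverse-onto : ∀ {x y z k m} → Walk H x y k → Walk H x z m → Walk H y z (k + m)
  reverse-onto (here _) acc = acc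
  reverse-onto {k = suc k} {m} (step a w) acc =
    subst (Walk H _ _) (+-suc k m) (reverse-onto w (step (trans (Graph.sym H _ _) a) acc))

  reverse : ∀ {x y k} → Walk H x y k → Walk H y x k
  reverse {k = k} w = subst (Walk H _ _) (+-identityʳ k) (reverse-onto w (here _))

module _ {t : ℕ} {G : Graph} where

  path-edge : (e : Edge G) → ∀ i → suc i ≤ t → E (S t G) (point t G e i) (point t G e (suc i))
  path-edge e i le = e , i , le , inj₁ (refl , refl)

  point-length : 1 ≤ t → (e : Edge G) → point t G e t ≡ inj₁ (proj₁ (proj₂ e))
  point-length (s≤s {n = t′} _) _ with suc t′ <? suc t′
  ... | yes lt = ⊥-elim (n≮n _ lt)
  ... | no  _  = refl

S⟶⇒⟶^^ : ∀ {t} (G H : Graph) → 1 ≤ t → S t G ⟶ toR H → toR G ⟶ H ^^ t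
S⟶⇒⟶^^ {t} G H 1≤t (f , f-hom) = (λ u → f (inj₁ u)) , walk
  where
  edge-walk : (e : Edge G) → Walk H (f (inj₁ (proj₁ e))) (f (inj₁ (proj₁ (proj₂ e)))) t
  edge-walk e = subst (λ z → Walk H (f (point t G e 0)) (f z) t) (point-length 1≤t e)
    (walk-along (λ i → f (point t G e i)) t (λ i le → f-hom _ _ (path-edge e i le)))

  walk : ∀ u v → adj G u v ≡ true → Walk H (f (inj₁ u)) (f (inj₁ v)) t
  walk u v uv with <-cmp u v
  ... | tri< u<v _ _ = edge-walk (u , v , u<v , uv)
  ... | tri> _ _ v<u = reverse (edge-walk (v , u , v<u , trans (Graph.sym G v u) uv))
  ... | tri≈ _ refl _ with trans (sym uv) (irrefl G u)
  ...   | ()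

⟶^^⇒S⟶ : ∀ {t} (G H : Graph) → toR G ⟶ H ^^ t → S t G ⟶ toR H
⟶^^⇒S⟶ {t} G H (g , g-hom) = F , F-hom
  where
  W : (e : Edge G) → Walk H (g (proj₁ e)) (g (proj₁ (proj₂ e))) t
  W (u , v , _ , uv) = g-hom u v uv

  F : SubV t G → Fin (n H)
  F (inj₁ u)       = g u
  F (inj₂ (e , j)) = vertex (W e) (suc (toℕ j))

  F-point : (e : Edge G) → ∀ i → F (point t G e i) ≡ vertex (W e) i
  F-point _ zero = refl
  F-point e (suc i) with suc i <? t
  ... | yes _  = cong (λ j → vertex (W e) (suc j)) (toℕ-fromℕ< _)
  ... | no i≮t = sym (vertex-≥length (W e) (≮⇒≥ i≮t))

  F-step : (e : Edge G) → ∀ i → suc i ≤ t → adj H (F (point t G e i)) (F (point t G e (suc i))) ≡ true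
  F-step e i le = subst₂ (λ x y → adj H x y ≡ true) (sym (F-point e i)) (sym (F-point e (suc i)))
                         (vertex-adjacent i (W e) le)

  F-hom : ∀ a b → E (S t G) a b → adj H (F a) (F b) ≡ true
  F-hom _ _ (e , i , le , inj₁ (refl , refl)) = F-step e i le
  F-hom _ _ (e , i , le , inj₂ (refl , refl)) = trans (Graph.sym H _ _) (F-step e i le)

lemma2p2 : (G H : Graph) (s : ℕ) → (OddGirth> (2 * s + 1)) H →
    (frac G s ⟶ toR H) ⇔ (toR G ⟶ (H ^^ (2 * s + 1)))
lemma2p2 G H s _ = mk⇔ (S⟶⇒⟶^^ G H (m≤n+m 1 (2 * s))) (⟶^^⇒S⟶ G H)
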